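{- Let $r\geq 2$, $n\geq r$ and $m\geq t_r(n)$, and let $G$ be any graph with $n$ vertices and $m$ edges. Then: (i) every $\mathfrak{P}$-sequence of $G$ has at least $r$ terms; (ii) for every $\mathfrak{P}$-sequence $v_1,\dots,v_k$ of $G$ (so $k\ge r$), its first $r$ terms satisfy $\sum_{i=1}^{r} d(v_i)\geq (r-1)n$; (iii) if equality $\sum_{i=1}^{r} d(v_i)=(r-1)n$ holds for the first $r$ terms $v_1,\dots,v_r$ of some $\mathfrak{P}$-sequence of $G$, then $m=t_r(n)$.
   Context: Graphs are finite and simple. $d(u)$ denotes the degree of a vertex $u$ and $\Gamma(u)$ its neighbourhood; for a set $U$ of vertices, $\widehat{\Gamma}(U)=\bigcap_{v\in U}\Gamma(v)$ is the common neighbourhood. $T_r(n)$ is the $r$-partite Turán graph on $n$ vertices (complete $r$-partite graph with part sizes differing by at most one) and $t_r(n)$ is its number of edges. The greedy algorithm $\mathfrak{P}$ constructs a clique $v_1,\dots,v_k$ in a graph $G$ as follows: $v_1$ is a vertex of maximum degree in $G$; having selected $v_1,\dots,v_{i-1}$, if $\widehat{\Gamma}(\{v_1,\dots,v_{i-1}\})=\varnothing$ the algorithm stops, otherwise it selects $v_i$ to be a vertex of maximum degree (degree in $G$) among the vertices of $\widehat{\Gamma}(\{v_1,\dots,v_{i-1}\})$, and repeats. Since ties may be broken arbitrarily, the output need not be unique; any sequence that can be produced by $\mathfrak{P}$ is called a $\mathfrak{P}$-sequence. -}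

module Defs where

open import Data.Bool using (Bool; true; false; not; _∧_; T; if_then_else_)
open import Data.Nat using (ℕ; zero; suc; _+_; _∸_; _*_; _≤_; _<ᵇ_; ∣_-_∣)
open import Data.Nat.Divisibility using (_∣?_)
open import Data.Fin using (Fin; toℕ)
open import Data.List using (List; []; _∷_; map; allFin; take; length)
open import Data.Nat.ListAction using (sum)
open import Data.List.Relation.Unary.All using (All)
open import Data.Product using (_×_)
open import Relation.Nullary using (¬_)
open import Relation.Nullary.Decidable using (⌊_⌋)
open import Relation.Binary.PropositionalEquality using (_≡_)

record Graph (n : ℕ) : Set where
  field
    adj    : Fin n → Fin n → Bool
    sym    : ∀ u v → adj u v ≡ adj v u
    irrefl : ∀ v → adj v v ≡ false
open Graph public

Adj : ∀ {n} → Graph n → Fin n → Fin n → Set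
Adj G u v = T (adj G u v)

indicator : Bool → ℕ
indicator b = if b then 1 else 0

deg : ∀ {n} → Graph n → Fin n → ℕ
deg {n} G u = sum (map (λ v → indicator (adj G u v)) (allFin n))

edges : ∀ {n} → Graph n → ℕ
edges {n} G =
  sum (map (λ i → sum (map (λ j → indicator ((toℕ i <ᵇ toℕ j) ∧ adj G i j)) (allFin n))) (allFin n))

-- Turán graph T_r(n): vertex i lies in part (i mod r); two vertices are
-- adjacent iff they lie in different parts, i.e. r does not divide |i - j|.
-- (Part sizes of residue classes differ by at most one.)
turanGraph : (r n : ℕ) → Graph n
turanGraph r n = record
  { adj    = λ i j → not ⌊ r ∣? ∣ toℕ i - toℕ j ∣ ⌋
  ; sym    = sym′
  ; irrefl = irr }
  where
    open import Data.Nat.Properties using (∣-∣-comm; n∸n≡0)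
    open import Relation.Binary.PropositionalEquality using (cong; refl)
    open import Data.Nat.Divisibility using (_∣0)
    open import Relation.Nullary.Decidable using (dec-true)
    sym′ : ∀ i j → not ⌊ r ∣? ∣ toℕ i - toℕ j ∣ ⌋ ≡ not ⌊ r ∣? ∣ toℕ j - toℕ i ∣ ⌋
    sym′ i j = cong (λ x → not ⌊ r ∣? x ⌋) (∣-∣-comm (toℕ i) (toℕ j))
    irr : ∀ i → not ⌊ r ∣? ∣ toℕ i - toℕ i ∣ ⌋ ≡ false
    irr i rewrite Data.Nat.Properties.∣n-n∣≡0 (toℕ i) with r ∣? 0
    ... | Relation.Nullary.yes _ = refl
    ... | Relation.Nullary.no ¬p = ⊥-elim (¬p (r ∣0))
      where open import Data.Empty using (⊥-elim)

t : ℕ → ℕ → ℕ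
t r n = edges (turanGraph r n)

-- w ∈ Γ̂(U): w is adjacent to every vertex of U (for U = [] this is every vertex)
CommonNbr : ∀ {n} → Graph n → List (Fin n) → Fin n → Set
CommonNbr G U w = All (λ v → Adj G v w) U

-- Greedy G chosen rest: having already chosen the vertices `chosen`,
-- the list `rest` is a valid continuation of the algorithm 𝔓 until it stops.
Greedy : ∀ {n} → Graph n → List (Fin n) → List (Fin n) → Set
Greedy G chosen []         = ∀ w → ¬ CommonNbr G chosen w
Greedy G chosen (v ∷ rest) =
  CommonNbr G chosen v ×
  (∀ w → CommonNbr G chosen w → deg G w ≤ deg G v) ×
  Greedy G (v ∷ chosen) rest

PSeq : ∀ {n} → Graph n → List (Fin n) → Set
PSeq G vs = Greedy G [] vs

-- Let v₁, v₂, … be a 𝔓-sequence and r = k + 1. Put a vertex u on level i ≤ k if u is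
-- adjacent to v₁, …, vᵢ but not to vᵢ₊₁ (level k: adjacent to all of v₁, …, v_k), and let
-- sᵢ be the size of level i and aᵢ = n − d(vᵢ₊₁), with d(vⱼ) = 0 past the end of the
-- sequence. Greedy maximality gives d(u) ≤ d(vᵢ₊₁) on level i, hence 2m + Σ sᵢaᵢ ≤ n².
-- Levels i < k consist of non-neighbours of vᵢ₊₁, so sᵢ ≤ aᵢ, and degrees decrease along
-- the sequence, so aᵢ ≤ a_k. With q ≥ 1 chosen so that 2t_r(n) + (2q+1)n = n² + rq(q+1),
-- the inequality (x − q)(x − q − 1) ≥ 0 applied level by level yields
-- (2q+1)n ≤ Σ sᵢaᵢ + rq(q+1) as soon as n ≤ Σ aᵢ = rn − Σ d(vᵢ), strictly if strictly.
-- So Σ d(vᵢ) ≤ (r−1)n forces m ≤ t_r(n) and Σ d(vᵢ) < (r−1)n forces m < t_r(n); a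
-- sequence shorter than r has Σ d(vᵢ) < (r−1)n because d(v₁) < n.
module Submission where

open import Defs hiding (sym)
open import Data.Bool using (Bool; true; false; not; _∧_; T; if_then_else_)
open import Data.Empty using (⊥-elim)
open import Data.Fin using (Fin; zero; suc; toℕ; fromℕ; inject₁)
open import Data.Fin.Properties using (_≟_; toℕ-injective; toℕ-inject₁; toℕ-fromℕ)
open import Data.Fin.Relation.Unary.Top using (view; ‵fromℕ; ‵inject₁)
open import Data.List using (List; []; _∷_; map; allFin; tabulate; take; length)
open import Data.List.Properties using (map-tabulate)
import Data.List.Relation.Unary.All as All
open import Data.List.Relation.Unary.All using ([]; _∷_)
open import Data.Nat using (ℕ; zero; suc; _+_; _*_; _∸_; _≤_; _<_; z≤n; s≤s; _≤?_; _<ᵇ_; >-nonZero)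
open import Data.Nat.Divisibility using (_∣_; _∣?_; ∣m+n∣m⇒∣n; ∣⇒≤; n∣m*n)
open import Data.Nat.ListAction using (sum)
open import Data.Nat.Properties hiding (_≟_)
open import Data.Nat.Tactic.RingSolver using (solve-∀)
open import Data.Product using (Σ; _×_; _,_)
open import Data.Sum using (inj₁; inj₂)
open import Relation.Binary.PropositionalEquality
open import Relation.Nullary using (¬_; yes; no; does)
open import Relation.Nullary.Decidable using (⌊_⌋)
open import Relation.Nullary.Reflects using (ofʸ; ofⁿ)
open import Algebra.Properties.Semiring.Sum +-*-semiring
  using (sum-syntax; sum-init-last; sum-cong-≗; sum-replicate-zero;
         ∑-distrib-+; ∑-comm; *-distribˡ-sum; *-distribʳ-sum)

-- Finite sums over Fin n

sum-tabulate : ∀ {n} (f : Fin n → ℕ) → sum (tabulate f) ≡ ∑[ i < n ] f i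
sum-tabulate {zero}  f = refl
sum-tabulate {suc n} f = cong (f zero +_) (sum-tabulate (λ i → f (suc i)))

sum-map-allFin : ∀ {n} (f : Fin n → ℕ) → sum (map f (allFin n)) ≡ ∑[ i < n ] f i
sum-map-allFin f = trans (cong sum (map-tabulate (λ i → i) f)) (sum-tabulate f)

∑-const : ∀ n c → ∑[ i < n ] c ≡ n * c
∑-const zero    c = refl
∑-const (suc n) c = cong (c +_) (∑-const n c)

∑-mono-≤ : ∀ {n} {f g : Fin n → ℕ} → (∀ i → f i ≤ g i) → ∑[ i < n ] f i ≤ ∑[ i < n ] g i
∑-mono-≤ {zero}  f≤g = z≤n
∑-mono-≤ {suc n} f≤g = +-mono-≤ (f≤g zero) (∑-mono-≤ (λ i → f≤g (suc i)))

∑-mono-< : ∀ {n} {f g : Fin n → ℕ} (j : Fin n) →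
           (∀ i → f i ≤ g i) → f j < g j → ∑[ i < n ] f i < ∑[ i < n ] g i
∑-mono-< zero    f≤g fj<gj = +-mono-<-≤ fj<gj (∑-mono-≤ (λ i → f≤g (suc i)))
∑-mono-< (suc j) f≤g fj<gj = +-mono-≤-< (f≤g zero) (∑-mono-< j (λ i → f≤g (suc i)) fj<gj)

∑-term≤ : ∀ {n} (f : Fin n → ℕ) (i : Fin n) → f i ≤ ∑[ j < n ] f j
∑-term≤ f zero    = m≤m+n _ _
∑-term≤ f (suc i) = ≤-trans (∑-term≤ (λ j → f (suc j)) i) (m≤n+m _ (f zero))

indicator≤1 : ∀ b → indicator b ≤ 1
indicator≤1 true  = ≤-refl
indicator≤1 false = z≤n

∑-indicator≤ : ∀ {n} (p : Fin n → Bool) → ∑[ i < n ] indicator (p i) ≤ n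
∑-indicator≤ {n} p = begin
  ∑[ i < n ] indicator (p i) ≤⟨ ∑-mono-≤ (λ i → indicator≤1 (p i)) ⟩
  ∑[ i < n ] 1               ≡⟨ ∑-const n 1 ⟩
  n * 1                      ≡⟨ *-identityʳ n ⟩
  n                          ∎
  where open ≤-Reasoning

∑-select : ∀ {r} (j : Fin r) (h : Fin r → ℕ) → ∑[ i < r ] (indicator (does (j ≟ i)) * h i) ≡ h j
∑-select {suc r} zero    h =
  trans (cong₂ _+_ (+-identityʳ (h zero)) (sum-replicate-zero r)) (+-identityʳ (h zero))
∑-select         (suc j) h = ∑-select j (λ i → h (suc i))

∑-fibres : ∀ {n r} (g : Fin n → Fin r) (h : Fin r → ℕ) →
           ∑[ u < n ] h (g u) ≡ ∑[ i < r ] ((∑[ u < n ] indicator (does (g u ≟ i))) * h i)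
∑-fibres {n} {r} g h = begin
  ∑[ u < n ] h (g u)
    ≡⟨ sum-cong-≗ (λ u → ∑-select (g u) h) ⟨
  ∑[ u < n ] ∑[ i < r ] (indicator (does (g u ≟ i)) * h i)
    ≡⟨ ∑-comm (λ u i → indicator (does (g u ≟ i)) * h i) ⟩
  ∑[ i < r ] ∑[ u < n ] (indicator (does (g u ≟ i)) * h i)
    ≡⟨ sum-cong-≗ (λ i → *-distribʳ-sum (h i) (λ u → indicator (does (g u ≟ i)))) ⟨
  ∑[ i < r ] ((∑[ u < n ] indicator (does (g u ≟ i))) * h i)
    ∎
  where open ≡-Reasoning

square-bound : ∀ q x → (2 * q + 1) * x ≤ x * x + q * suc q
square-bound q x with x ≤? q
... | yes x≤q with y , refl ← m≤n⇒∃[o]m+o≡n x≤q =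
  m+n≤o⇒m≤o _ (≤-reflexive (identity x y))
  where
  identity : ∀ x y → (2 * (x + y) + 1) * x + (y * y + y) ≡ x * x + (x + y) * suc (x + y)
  identity = solve-∀
... | no x≰q with y , refl ← m≤n⇒∃[o]m+o≡n (≰⇒> x≰q) =
  m+n≤o⇒m≤o _ (≤-reflexive (identity q y))
  where
  identity : ∀ q y → (2 * q + 1) * (suc q + y) + (y * y + y) ≡ (suc q + y) * (suc q + y) + q * suc q
  identity = solve-∀

product-bound : ∀ q x y → x + y ≡ 2 * q + 1 → x * y ≤ q * suc q
product-bound q x y x+y≡c = +-cancelˡ-≤ (x * x) (x * y) (q * suc q) (begin
  x * x + x * y       ≡⟨ *-distribˡ-+ x x y ⟨
  x * (x + y)         ≡⟨ cong (x *_) x+y≡c ⟩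
  x * (2 * q + 1)     ≡⟨ *-comm x _ ⟩
  (2 * q + 1) * x     ≤⟨ square-bound q x ⟩
  x * x + q * suc q   ∎)
  where open ≤-Reasoning

term-bound : ∀ q {s a} → s ≤ a → (2 * q + 1) * s ≤ s * a + q * suc q
term-bound q {s} {a} s≤a = begin
  (2 * q + 1) * s     ≤⟨ square-bound q s ⟩
  s * s + q * suc q   ≤⟨ +-monoˡ-≤ _ (*-monoʳ-≤ s s≤a) ⟩
  s * a + q * suc q   ∎
  where open ≤-Reasoning

shifted-term-bound : ∀ q {s a L μ} → s ≤ a → a ≤ L → L + μ ≡ 2 * q + 1 →
                     L * s + μ * a ≤ s * a + q * suc q
shifted-term-bound q {s} {a} {L} {μ} s≤a a≤L L+μ≡c with e , refl ← m≤n⇒∃[o]m+o≡n a≤L = begin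
  (a + e) * s + μ * a     ≡⟨ regroup a e s μ ⟩
  s * a + (e * s + μ * a) ≤⟨ +-monoʳ-≤ (s * a) (+-monoˡ-≤ (μ * a) (*-monoʳ-≤ e s≤a)) ⟩
  s * a + (e * a + μ * a) ≡⟨ cong (s * a +_) (factor a e μ) ⟩
  s * a + a * (e + μ)     ≤⟨ +-monoʳ-≤ (s * a) (product-bound q a (e + μ) a+[e+μ]≡c) ⟩
  s * a + q * suc q       ∎
  where
  open ≤-Reasoning
  a+[e+μ]≡c : a + (e + μ) ≡ 2 * q + 1
  a+[e+μ]≡c = trans (sym (+-assoc a e μ)) L+μ≡c
  regroup : ∀ a e s μ → (a + e) * s + μ * a ≡ s * a + (e * s + μ * a)
  regroup = solve-∀
  factor : ∀ a e μ → e * a + μ * a ≡ a * (e + μ)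
  factor = solve-∀

shifted-last-term-bound : ∀ q {σ L μ} → L + μ ≡ 2 * q + 1 → L * σ + μ * L ≤ σ * L + q * suc q
shifted-last-term-bound q {σ} {L} {μ} L+μ≡c = begin
  L * σ + μ * L     ≡⟨ cong₂ _+_ (*-comm L σ) (*-comm μ L) ⟩
  σ * L + L * μ     ≤⟨ +-monoʳ-≤ (σ * L) (product-bound q L μ L+μ≡c) ⟩
  σ * L + q * suc q ∎
  where open ≤-Reasoning

-- If the last level is small (L < c), the constraint Σ sᵢ ≤ Σ aᵢ is used with the
-- multiplier μ = c − L: it makes every level, including the unconstrained last one,
-- contribute at most sᵢaᵢ + K.
module _ (q k : ℕ) (s a : Fin (suc k) → ℕ)
         (s≤a : ∀ j → s (inject₁ j) ≤ a (inject₁ j))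
         (a≤aₖ : ∀ j → a (inject₁ j) ≤ a (fromℕ k)) where

  private
    c K L N A Ψ : ℕ
    c = 2 * q + 1
    K = q * suc q
    L = a (fromℕ k)
    N = ∑[ i < suc k ] s i
    A = ∑[ i < suc k ] a i
    Ψ = ∑[ i < suc k ] (s i * a i)

    ∑-products : ∑[ i < suc k ] (s i * a i + K) ≡ Ψ + suc k * K
    ∑-products = trans (∑-distrib-+ (λ i → s i * a i) (λ _ → K)) (cong (Ψ +_) (∑-const (suc k) K))

    last-term : c ≤ L → c * s (fromℕ k) ≤ s (fromℕ k) * L
    last-term c≤L = ≤-trans (≤-reflexive (*-comm c _)) (*-monoʳ-≤ (s (fromℕ k)) c≤L)

    terms-bound : c ≤ L → ∀ i → c * s i ≤ s i * a i + K
    terms-bound c≤L i with view i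
    ... | ‵fromℕ     = ≤-trans (last-term c≤L) (m≤m+n _ K)
    ... | ‵inject₁ j = term-bound q (s≤a j)

    last-term-strict : 1 ≤ q → c ≤ L → c * s (fromℕ k) < s (fromℕ k) * L + K
    last-term-strict 1≤q c≤L = ≤-<-trans (last-term c≤L) (m<m+n _ (*-mono-≤ 1≤q (s≤s z≤n)))

    shifted-terms-bound : ∀ {μ} → L + μ ≡ c → ∀ i → L * s i + μ * a i ≤ s i * a i + K
    shifted-terms-bound L+μ≡c i with view i
    ... | ‵fromℕ     = shifted-last-term-bound q {σ = s (fromℕ k)} {L} L+μ≡c
    ... | ‵inject₁ j = shifted-term-bound q (s≤a j) (a≤aₖ j) L+μ≡c

    shifted-sum-bound : ∀ {μ} → L + μ ≡ c → L * N + μ * A ≤ Ψ + suc k * K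
    shifted-sum-bound {μ} L+μ≡c = begin
      L * N + μ * A                      ≡⟨ cong₂ _+_ (*-distribˡ-sum L s) (*-distribˡ-sum μ a) ⟩
      ∑[ i < suc k ] (L * s i) + ∑[ i < suc k ] (μ * a i)
                                         ≡⟨ ∑-distrib-+ (λ i → L * s i) (λ i → μ * a i) ⟨
      ∑[ i < suc k ] (L * s i + μ * a i) ≤⟨ ∑-mono-≤ (shifted-terms-bound L+μ≡c) ⟩
      ∑[ i < suc k ] (s i * a i + K)     ≡⟨ ∑-products ⟩
      Ψ + suc k * K                      ∎
      where open ≤-Reasoning

    L+[c∸L]≡c : ¬ c ≤ L → L + (c ∸ L) ≡ c
    L+[c∸L]≡c c≰L = m+[n∸m]≡n (<⇒≤ (≰⇒> c≰L))

    split-multiplier : ∀ {μ} → L + μ ≡ c → c * N ≡ L * N + μ * N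
    split-multiplier {μ} L+μ≡c = trans (cong (_* N) (sym L+μ≡c)) (*-distribʳ-+ N L μ)

  level-bound : ∑[ i < suc k ] s i ≤ ∑[ i < suc k ] a i →
                (2 * q + 1) * ∑[ i < suc k ] s i ≤ ∑[ i < suc k ] (s i * a i) + suc k * (q * suc q)
  level-bound N≤A with c ≤? L
  ... | yes c≤L = begin
    c * N                          ≡⟨ *-distribˡ-sum c s ⟩
    ∑[ i < suc k ] (c * s i)       ≤⟨ ∑-mono-≤ (terms-bound c≤L) ⟩
    ∑[ i < suc k ] (s i * a i + K) ≡⟨ ∑-products ⟩
    Ψ + suc k * K                  ∎
    where open ≤-Reasoning
  ... | no c≰L = begin
    c * N                 ≡⟨ split-multiplier (L+[c∸L]≡c c≰L) ⟩
    L * N + (c ∸ L) * N   ≤⟨ +-monoʳ-≤ (L * N) (*-monoʳ-≤ (c ∸ L) N≤A) ⟩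
    L * N + (c ∸ L) * A   ≤⟨ shifted-sum-bound (L+[c∸L]≡c c≰L) ⟩
    Ψ + suc k * K         ∎
    where open ≤-Reasoning

  level-bound-strict : 1 ≤ q → ∑[ i < suc k ] s i < ∑[ i < suc k ] a i →
                       (2 * q + 1) * ∑[ i < suc k ] s i < ∑[ i < suc k ] (s i * a i) + suc k * (q * suc q)
  level-bound-strict 1≤q N<A with c ≤? L
  ... | yes c≤L = begin-strict
    c * N                          ≡⟨ *-distribˡ-sum c s ⟩
    ∑[ i < suc k ] (c * s i)       <⟨ ∑-mono-< (fromℕ k) (terms-bound c≤L) (last-term-strict 1≤q c≤L) ⟩
    ∑[ i < suc k ] (s i * a i + K) ≡⟨ ∑-products ⟩
    Ψ + suc k * K                  ∎
    where open ≤-Reasoning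
  ... | no c≰L = begin-strict
    c * N                 ≡⟨ split-multiplier (L+[c∸L]≡c c≰L) ⟩
    L * N + (c ∸ L) * N   <⟨ +-monoʳ-< (L * N) (*-monoʳ-< (c ∸ L) {{c∸L≢0}} N<A) ⟩
    L * N + (c ∸ L) * A   ≤⟨ shifted-sum-bound (L+[c∸L]≡c c≰L) ⟩
    Ψ + suc k * K         ∎
    where
    open ≤-Reasoning
    c∸L≢0 = >-nonZero (m<n⇒0<n∸m (≰⇒> c≰L))

halve-≤ : ∀ {m t Ψ S C R} → 2 * m + Ψ ≤ S → 2 * t + C ≡ S + R → C ≤ Ψ + R → m ≤ t
halve-≤ {m} {t} {Ψ} {S} {C} {R} 2m+Ψ≤S 2t+C≡S+R C≤Ψ+R =
  *-cancelˡ-≤ 2 (+-cancelʳ-≤ (Ψ + R) (2 * m) (2 * t) (begin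
    2 * m + (Ψ + R) ≡⟨ +-assoc (2 * m) Ψ R ⟨
    2 * m + Ψ + R   ≤⟨ +-monoˡ-≤ R 2m+Ψ≤S ⟩
    S + R           ≡⟨ 2t+C≡S+R ⟨
    2 * t + C       ≤⟨ +-monoʳ-≤ (2 * t) C≤Ψ+R ⟩
    2 * t + (Ψ + R) ∎))
  where open ≤-Reasoning

halve-< : ∀ {m t Ψ S C R} → 2 * m + Ψ ≤ S → 2 * t + C ≡ S + R → C < Ψ + R → m < t
halve-< {m} {t} {Ψ} {S} {C} {R} 2m+Ψ≤S 2t+C≡S+R C<Ψ+R =
  *-cancelˡ-< 2 m t (+-cancelʳ-< (Ψ + R) (2 * m) (2 * t) (begin-strict
    2 * m + (Ψ + R) ≡⟨ +-assoc (2 * m) Ψ R ⟨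
    2 * m + Ψ + R   ≤⟨ +-monoˡ-≤ R 2m+Ψ≤S ⟩
    S + R           ≡⟨ 2t+C≡S+R ⟨
    2 * t + C       <⟨ +-monoʳ-< (2 * t) C<Ψ+R ⟩
    2 * t + (Ψ + R) ∎))
  where open ≤-Reasoning

module _ {n} (G : Graph n) where

  edge< : Fin n → Fin n → ℕ
  edge< i j = indicator ((toℕ i <ᵇ toℕ j) ∧ adj G i j)

  edges≡∑ : edges G ≡ ∑[ i < n ] ∑[ j < n ] edge< i j
  edges≡∑ = trans (sum-map-allFin (λ i → sum (map (edge< i) (allFin n))))
                  (sum-cong-≗ (λ i → sum-map-allFin (edge< i)))

  deg≡∑ : ∀ u → deg G u ≡ ∑[ v < n ] indicator (adj G u v)
  deg≡∑ u = sum-map-allFin (λ v → indicator (adj G u v))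

  adj≡edge<+edge> : ∀ i j → indicator (adj G i j) ≡ edge< i j + edge< j i
  adj≡edge<+edge> i j with toℕ i <ᵇ toℕ j | <ᵇ-reflects-< (toℕ i) (toℕ j)
                         | toℕ j <ᵇ toℕ i | <ᵇ-reflects-< (toℕ j) (toℕ i)
  ... | true  | ofʸ i<j | true  | ofʸ j<i = ⊥-elim (<-asym i<j j<i)
  ... | true  | _       | false | _       = sym (+-identityʳ _)
  ... | false | _       | true  | _       = cong indicator (Graph.sym G i j)
  ... | false | ofⁿ i≮j | false | ofⁿ j≮i
    rewrite toℕ-injective (≤-antisym (≮⇒≥ j≮i) (≮⇒≥ i≮j)) = cong indicator (irrefl G j)

  handshake : ∑[ u < n ] deg G u ≡ 2 * edges G
  handshake = begin
    ∑[ u < n ] deg G u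
      ≡⟨ sum-cong-≗ (λ u → trans (deg≡∑ u) (sum-cong-≗ (adj≡edge<+edge> u))) ⟩
    ∑[ i < n ] ∑[ j < n ] (edge< i j + edge< j i)
      ≡⟨ sum-cong-≗ (λ i → ∑-distrib-+ (edge< i) (λ j → edge< j i)) ⟩
    ∑[ i < n ] (∑[ j < n ] edge< i j + ∑[ j < n ] edge< j i)
      ≡⟨ ∑-distrib-+ (λ i → ∑[ j < n ] edge< i j) (λ i → ∑[ j < n ] edge< j i) ⟩
    ∑[ i < n ] ∑[ j < n ] edge< i j + ∑[ i < n ] ∑[ j < n ] edge< j i
      ≡⟨ cong₂ _+_ edges≡∑ (trans edges≡∑ (∑-comm edge<)) ⟨
    edges G + edges G
      ≡⟨ cong (edges G +_) (+-identityʳ (edges G)) ⟨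
    2 * edges G
      ∎
    where open ≡-Reasoning

  deg≤n : ∀ u → deg G u ≤ n
  deg≤n u = subst (_≤ n) (sym (deg≡∑ u)) (∑-indicator≤ (adj G u))

  non-neighbours+deg : ∀ u → ∑[ v < n ] indicator (not (adj G u v)) + deg G u ≡ n
  non-neighbours+deg u = begin
    ∑[ v < n ] indicator (not (adj G u v)) + deg G u
      ≡⟨ cong (∑[ v < n ] indicator (not (adj G u v)) +_) (deg≡∑ u) ⟩
    ∑[ v < n ] indicator (not (adj G u v)) + ∑[ v < n ] indicator (adj G u v)
      ≡⟨ ∑-distrib-+ (λ v → indicator (not (adj G u v))) (λ v → indicator (adj G u v)) ⟨
    ∑[ v < n ] (indicator (not (adj G u v)) + indicator (adj G u v))
      ≡⟨ sum-cong-≗ (λ v → indicator-not+indicator (adj G u v)) ⟩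
    ∑[ v < n ] 1
      ≡⟨ trans (∑-const n 1) (*-identityʳ n) ⟩
    n ∎
    where
    open ≡-Reasoning
    indicator-not+indicator : ∀ b → indicator (not b) + indicator b ≡ 1
    indicator-not+indicator true  = refl
    indicator-not+indicator false = refl

  deg<n : ∀ u → deg G u < n
  deg<n u = begin-strict
    deg G u                                          <⟨ n<1+n _ ⟩
    1 + deg G u                                      ≡⟨ cong (λ b → indicator (not b) + deg G u) (irrefl G u) ⟨
    indicator (not (adj G u u)) + deg G u            ≤⟨ +-monoˡ-≤ (deg G u) (∑-term≤ non-neighbour u) ⟩
    ∑[ v < n ] indicator (not (adj G u v)) + deg G u ≡⟨ non-neighbours+deg u ⟩
    n                                                ∎
    where
    open ≤-Reasoning
    non-neighbour : Fin n → ℕ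
    non-neighbour v = indicator (not (adj G u v))

-- The Turán number

nonMultiples : ℕ → ℕ → ℕ
nonMultiples r n = ∑[ j < n ] indicator (not ⌊ r ∣? suc (toℕ j) ⌋)

-- Vertex 0 of T_r(n+1) is adjacent exactly to the vertices j+1 with r ∤ j+1, and the
-- remaining vertices induce a copy of T_r(n); both facts hold by computation.
t-suc : ∀ r n → t r (suc n) ≡ nonMultiples r n + t r n
t-suc r n = trans (edges≡∑ (turanGraph r (suc n))) (cong (nonMultiples r n +_) (sym (edges≡∑ (turanGraph r n))))

nonMultiples-suc : ∀ r n → nonMultiples r (suc n) ≡ nonMultiples r n + indicator (not ⌊ r ∣? suc n ⌋)
nonMultiples-suc r n =
  trans (sum-init-last {n} (λ j → ind (toℕ j)))
        (cong₂ _+_ (sum-cong-≗ {n} (λ j → cong ind (toℕ-inject₁ j))) (cong ind (toℕ-fromℕ n)))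
  where
  ind : ℕ → ℕ
  ind j = indicator (not ⌊ r ∣? suc j ⌋)

nonMultiples-suc-∤ : ∀ {r n} → ¬ r ∣ suc n → nonMultiples r (suc n) ≡ suc (nonMultiples r n)
nonMultiples-suc-∤ {r} {n} r∤1+n with r ∣? suc n | nonMultiples-suc r n
... | yes r∣1+n | _  = ⊥-elim (r∤1+n r∣1+n)
... | no  _     | eq = trans eq (+-comm (nonMultiples r n) 1)

nonMultiples-suc-∣ : ∀ {r n} → r ∣ suc n → nonMultiples r (suc n) ≡ nonMultiples r n
nonMultiples-suc-∣ {r} {n} r∣1+n with r ∣? suc n | nonMultiples-suc r n
... | yes _     | eq = trans eq (+-identityʳ (nonMultiples r n))
... | no  r∤1+n | _  = ⊥-elim (r∤1+n r∣1+n)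

-- For n = qr + ρ with ρ < r, T_r(n) has ρ parts of size q+1 and r − ρ of size q, and
-- 2t_r(n) = n² − Σ (part size)² rearranges to this.
TuránIdentity : ℕ → ℕ → ℕ → Set
TuránIdentity r n q = 2 * t r n + (2 * q + 1) * n ≡ n * n + r * (q * suc q)

turán-identity-suc : ∀ {r n q} → nonMultiples r n + q ≡ n → TuránIdentity r n q → TuránIdentity r (suc n) q
turán-identity-suc {r} {n} {q} count identity = begin
  2 * t r (suc n) + (2 * q + 1) * suc n                   ≡⟨ cong (λ T → 2 * T + (2 * q + 1) * suc n) (t-suc r n) ⟩
  2 * (nonMultiples r n + t r n) + (2 * q + 1) * suc n    ≡⟨ regroup (nonMultiples r n) (t r n) q n ⟩
  (2 * t r n + (2 * q + 1) * n) + (2 * (nonMultiples r n + q) + 1)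
                                                          ≡⟨ cong₂ (λ x y → x + (2 * y + 1)) identity count ⟩
  (n * n + r * (q * suc q)) + (2 * n + 1)                 ≡⟨ complete-square n (r * (q * suc q)) ⟩
  suc n * suc n + r * (q * suc q)                         ∎
  where
  open ≡-Reasoning
  regroup : ∀ b T q n → 2 * (b + T) + (2 * q + 1) * suc n ≡ (2 * T + (2 * q + 1) * n) + (2 * (b + q) + 1)
  regroup = solve-∀
  complete-square : ∀ n x → (n * n + x) + (2 * n + 1) ≡ suc n * suc n + x
  complete-square = solve-∀

turán-identity-shift : ∀ {r n q} → n ≡ suc q * r → TuránIdentity r n q → TuránIdentity r n (suc q)
turán-identity-shift {r} {n} {q} n≡[q+1]r identity = begin
  2 * t r n + (2 * suc q + 1) * n                    ≡⟨ regroup (t r n) q n ⟩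
  (2 * t r n + (2 * q + 1) * n) + 2 * n              ≡⟨ cong₂ (λ x y → x + 2 * y) identity n≡[q+1]r ⟩
  (n * n + r * (q * suc q)) + 2 * (suc q * r)        ≡⟨ collect n r q ⟩
  n * n + r * (suc q * suc (suc q))                  ∎
  where
  open ≡-Reasoning
  regroup : ∀ T q n → 2 * T + (2 * suc q + 1) * n ≡ (2 * T + (2 * q + 1) * n) + 2 * n
  regroup = solve-∀
  collect : ∀ n r q → (n * n + r * (q * suc q)) + 2 * (suc q * r) ≡ n * n + r * (suc q * suc (suc q))
  collect = solve-∀

record TuránData (r n : ℕ) : Set where
  field
    q ρ            : ℕ
    n≡qr+ρ         : n ≡ q * r + ρ
    ρ<r            : ρ < r
    nonMultiples+q : nonMultiples r n + q ≡ n
    identity       : TuránIdentity r n q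

turánData-suc : ∀ {r n} → 1 ≤ r → TuránData r n → TuránData r (suc n)
turánData-suc {r} {n} 1≤r
  record { q = q ; ρ = ρ ; n≡qr+ρ = n≡qr+ρ ; ρ<r = ρ<r ; nonMultiples+q = count ; identity = identity }
  with m≤n⇒m<n∨m≡n ρ<r
... | inj₁ 1+ρ<r = record
  { q = q ; ρ = suc ρ ; n≡qr+ρ = 1+n≡qr+1+ρ ; ρ<r = 1+ρ<r
  ; nonMultiples+q = trans (cong (_+ q) (nonMultiples-suc-∤ r∤1+n)) (cong suc count)
  ; identity = turán-identity-suc {q = q} count identity }
  where
  1+n≡qr+1+ρ : suc n ≡ q * r + suc ρ
  1+n≡qr+1+ρ = trans (cong suc n≡qr+ρ) (sym (+-suc (q * r) ρ))
  r∤1+n : ¬ r ∣ suc n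
  r∤1+n r∣1+n = <⇒≱ 1+ρ<r (∣⇒≤ (∣m+n∣m⇒∣n (subst (r ∣_) 1+n≡qr+1+ρ r∣1+n) (n∣m*n q)))
... | inj₂ 1+ρ≡r = record
  { q = suc q ; ρ = 0 ; n≡qr+ρ = trans 1+n≡[q+1]r (sym (+-identityʳ _)) ; ρ<r = 1≤r
  ; nonMultiples+q = trans (cong (_+ suc q) (nonMultiples-suc-∣ r∣1+n))
                           (trans (+-suc (nonMultiples r n) q) (cong suc count))
  ; identity = turán-identity-shift {q = q} 1+n≡[q+1]r (turán-identity-suc {q = q} count identity) }
  where
  open ≡-Reasoning
  1+n≡[q+1]r : suc n ≡ suc q * r
  1+n≡[q+1]r = begin
    suc n           ≡⟨ cong suc n≡qr+ρ ⟩
    suc (q * r + ρ) ≡⟨ +-suc (q * r) ρ ⟨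
    q * r + suc ρ   ≡⟨ cong (q * r +_) 1+ρ≡r ⟩
    q * r + r       ≡⟨ +-comm (q * r) r ⟩
    suc q * r       ∎
  r∣1+n : r ∣ suc n
  r∣1+n = subst (r ∣_) (sym 1+n≡[q+1]r) (n∣m*n (suc q))

turánData : ∀ {r} n → 1 ≤ r → TuránData r n
turánData {r} zero    1≤r = record
  { q = 0 ; ρ = 0 ; n≡qr+ρ = refl ; ρ<r = 1≤r ; nonMultiples+q = refl ; identity = sym (*-zeroʳ r) }
turánData     (suc n) 1≤r = turánData-suc 1≤r (turánData n 1≤r)

turán-identity : ∀ {r n} → 1 ≤ r → r ≤ n → Σ ℕ λ q → 1 ≤ q × TuránIdentity r n q
turán-identity {r} {n} 1≤r r≤n with turánData n 1≤r
... | record { q = zero ; ρ = ρ ; n≡qr+ρ = n≡ρ ; ρ<r = ρ<r } =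
  ⊥-elim (<⇒≱ ρ<r (subst (r ≤_) n≡ρ r≤n))
... | record { q = suc q ; identity = identity } = suc q , s≤s z≤n , identity

-- Levels of a 𝔓-sequence

module _ {n} (G : Graph n) where

  degAt : ∀ {r} → List (Fin n) → Fin r → ℕ
  degAt []       _       = 0
  degAt (v ∷ vs) zero    = deg G v
  degAt (v ∷ vs) (suc i) = degAt vs i

  level : (k : ℕ) → List (Fin n) → Fin n → Fin (suc k)
  level zero    _        _ = zero
  level (suc k) []       _ = zero
  level (suc k) (v ∷ vs) u = if adj G v u then suc (level k vs u) else zero

  levelSize : (k : ℕ) → List (Fin n) → Fin (suc k) → ℕ
  levelSize k vs i = ∑[ u < n ] indicator (does (level k vs u ≟ i))

  sum-take≡∑degAt : ∀ r vs → sum (map (deg G) (take r vs)) ≡ ∑[ i < r ] degAt vs i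
  sum-take≡∑degAt zero    vs       = refl
  sum-take≡∑degAt (suc r) []       = sym (sum-replicate-zero (suc r))
  sum-take≡∑degAt (suc r) (v ∷ vs) = cong (deg G v +_) (sum-take≡∑degAt r vs)

  degAt≤n : ∀ {r} vs (i : Fin r) → degAt vs i ≤ n
  degAt≤n []       _       = z≤n
  degAt≤n (v ∷ vs) zero    = deg≤n G v
  degAt≤n (v ∷ vs) (suc i) = degAt≤n vs i

  degAt-head<n : ∀ {r} vs → 1 ≤ n → degAt vs (zero {r}) < n
  degAt-head<n []      1≤n = 1≤n
  degAt-head<n (v ∷ _) _   = deg<n G v

  degAt-last≡0 : ∀ {k} vs → length vs ≤ k → degAt vs (fromℕ k) ≡ 0
  degAt-last≡0 []       _           = refl
  degAt-last≡0 (v ∷ vs) (s≤s len≤k) = degAt-last≡0 vs len≤k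

  short⇒∑degAt<k*n : ∀ {k} vs → length vs ≤ k → 1 ≤ k → 1 ≤ n → ∑[ i < suc k ] degAt vs i < k * n
  short⇒∑degAt<k*n {suc k} vs len≤k (s≤s z≤n) 1≤n = begin-strict
    ∑[ i < suc (suc k) ] degAt vs i
      ≡⟨ sum-init-last (degAt vs) ⟩
    ∑[ j < suc k ] degAt vs (inject₁ j) + degAt vs (fromℕ (suc k))
      ≡⟨ cong (∑[ j < suc k ] degAt vs (inject₁ j) +_) (degAt-last≡0 vs len≤k) ⟩
    ∑[ j < suc k ] degAt vs (inject₁ j) + 0
      ≡⟨ +-identityʳ _ ⟩
    ∑[ j < suc k ] degAt vs (inject₁ j)
      <⟨ ∑-mono-< zero (λ j → degAt≤n vs (inject₁ j)) (degAt-head<n vs 1≤n) ⟩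
    ∑[ j < suc k ] n
      ≡⟨ ∑-const (suc k) n ⟩
    suc k * n
      ∎
    where open ≤-Reasoning

  deg≤degAt-level : ∀ k {ch vs u} → Greedy G ch vs → CommonNbr G ch u → deg G u ≤ degAt vs (level k vs u)
  deg≤degAt-level k       {vs = []}             greedy                 u∈Γ̂ = ⊥-elim (greedy _ u∈Γ̂)
  deg≤degAt-level zero    {vs = v ∷ vs}         (_ , maximal , _)      u∈Γ̂ = maximal _ u∈Γ̂
  deg≤degAt-level (suc k) {vs = v ∷ vs} {u = u} (_ , maximal , greedy) u∈Γ̂ with adj G v u in v~u
  ... | true  = deg≤degAt-level k greedy (subst T (sym v~u) _ ∷ u∈Γ̂)
  ... | false = maximal u u∈Γ̂

  levelSize+degAt≤n : ∀ {k} vs (j : Fin k) → levelSize k vs (inject₁ j) + degAt vs (inject₁ j) ≤ n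
  levelSize+degAt≤n {suc k} [] j = ≤-trans (≤-reflexive (+-identityʳ _)) (∑-indicator≤ _)
  levelSize+degAt≤n {suc k} (v ∷ vs) zero = begin
    levelSize (suc k) (v ∷ vs) zero + deg G v
      ≤⟨ +-monoˡ-≤ (deg G v) (∑-mono-≤ level0⇒non-neighbour) ⟩
    ∑[ u < n ] indicator (not (adj G v u)) + deg G v
      ≡⟨ non-neighbours+deg G v ⟩
    n ∎
    where
    open ≤-Reasoning
    level0⇒non-neighbour : ∀ u → indicator (does (level (suc k) (v ∷ vs) u ≟ zero))
                               ≤ indicator (not (adj G v u))
    level0⇒non-neighbour u with adj G v u
    ... | true  = z≤n
    ... | false = ≤-refl
  levelSize+degAt≤n {suc k} (v ∷ vs) (suc j) = begin
    levelSize (suc k) (v ∷ vs) (suc (inject₁ j)) + degAt vs (inject₁ j)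
      ≤⟨ +-monoˡ-≤ (degAt vs (inject₁ j)) (∑-mono-≤ level-suc⇒level) ⟩
    levelSize k vs (inject₁ j) + degAt vs (inject₁ j)
      ≤⟨ levelSize+degAt≤n vs j ⟩
    n ∎
    where
    open ≤-Reasoning
    level-suc⇒level : ∀ u → indicator (does (level (suc k) (v ∷ vs) u ≟ suc (inject₁ j)))
                          ≤ indicator (does (level k vs u ≟ inject₁ j))
    level-suc⇒level u with adj G v u
    ... | true  = ≤-refl
    ... | false = z≤n

  degAt≤max : ∀ {ch vs b} → Greedy G ch vs → (∀ w → CommonNbr G ch w → deg G w ≤ b) →
              ∀ {r} (i : Fin r) → degAt vs i ≤ b
  degAt≤max {vs = []}     _                _     _       = z≤n
  degAt≤max {vs = v ∷ vs} (v∈Γ̂ , _ , _)    bound zero    = bound v v∈Γ̂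
  degAt≤max {vs = v ∷ vs} (_ , _ , greedy) bound (suc i) =
    degAt≤max greedy (λ w w∈Γ̂ → bound w (All.tail w∈Γ̂)) i

  degAt-antitone : ∀ {ch vs k} → Greedy G ch vs → (j : Fin k) → degAt vs (fromℕ k) ≤ degAt vs (inject₁ j)
  degAt-antitone {vs = []}     _                      _       = z≤n
  degAt-antitone {vs = v ∷ vs} (_ , maximal , greedy) zero    =
    degAt≤max greedy (λ w w∈Γ̂ → maximal w (All.tail w∈Γ̂)) (fromℕ _)
  degAt-antitone {vs = v ∷ vs} (_ , _ , greedy)       (suc j) = degAt-antitone greedy j

-- Few greedy degrees force few edges

module _ {n} (G : Graph n) (k : ℕ) {vs : List (Fin n)} (greedy : PSeq G vs) where

  private
    a : Fin (suc k) → ℕ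
    a i = n ∸ degAt G vs i

    A Ψ : ℕ
    A = ∑[ i < suc k ] a i
    Ψ = ∑[ i < suc k ] (levelSize G k vs i * a i)

    ∑levelSize≡n : ∑[ i < suc k ] levelSize G k vs i ≡ n
    ∑levelSize≡n = begin
      ∑[ i < suc k ] levelSize G k vs i       ≡⟨ sum-cong-≗ (λ i → *-identityʳ (levelSize G k vs i)) ⟨
      ∑[ i < suc k ] (levelSize G k vs i * 1) ≡⟨ ∑-fibres (level G k vs) (λ _ → 1) ⟨
      ∑[ u < n ] 1                            ≡⟨ ∑-const n 1 ⟩
      n * 1                                   ≡⟨ *-identityʳ n ⟩
      n                                       ∎
      where open ≡-Reasoning

    vertex-bound : 2 * edges G + Ψ ≤ n * n
    vertex-bound = begin
      2 * edges G + Ψ                                    ≡⟨ cong₂ _+_ (handshake G) (∑-fibres (level G k vs) a) ⟨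
      ∑[ u < n ] deg G u + ∑[ u < n ] a (level G k vs u) ≡⟨ ∑-distrib-+ (deg G) (λ u → a (level G k vs u)) ⟨
      ∑[ u < n ] (deg G u + a (level G k vs u))          ≤⟨ ∑-mono-≤ deg+a≤n ⟩
      ∑[ u < n ] n                                       ≡⟨ ∑-const n n ⟩
      n * n                                              ∎
      where
      open ≤-Reasoning
      deg+a≤n : ∀ u → deg G u + a (level G k vs u) ≤ n
      deg+a≤n u = ≤-trans (+-monoˡ-≤ _ (deg≤degAt-level G k greedy []))
                          (≤-reflexive (m+[n∸m]≡n (degAt≤n G vs (level G k vs u))))

    A+∑degAt : A + ∑[ i < suc k ] degAt G vs i ≡ n + k * n
    A+∑degAt = begin
      A + ∑[ i < suc k ] degAt G vs i     ≡⟨ ∑-distrib-+ a (degAt G vs) ⟨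
      ∑[ i < suc k ] (a i + degAt G vs i) ≡⟨ sum-cong-≗ (λ i → m∸n+n≡m (degAt≤n G vs i)) ⟩
      ∑[ i < suc k ] n                    ≡⟨ ∑-const (suc k) n ⟩
      n + k * n                           ∎
      where open ≡-Reasoning

    s≤a : ∀ j → levelSize G k vs (inject₁ j) ≤ a (inject₁ j)
    s≤a j = m+n≤o⇒m≤o∸n _ (levelSize+degAt≤n G vs j)

    a≤aₖ : ∀ j → a (inject₁ j) ≤ a (fromℕ k)
    a≤aₖ j = ∸-monoʳ-≤ n (degAt-antitone G greedy j)

    levels-bound : ∀ q → n ≤ A → (2 * q + 1) * n ≤ Ψ + suc k * (q * suc q)
    levels-bound q n≤A = subst (λ N → (2 * q + 1) * N ≤ Ψ + suc k * (q * suc q)) ∑levelSize≡n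
      (level-bound q k (levelSize G k vs) a s≤a a≤aₖ (subst (_≤ A) (sym ∑levelSize≡n) n≤A))

    levels-bound-strict : ∀ q → 1 ≤ q → n < A → (2 * q + 1) * n < Ψ + suc k * (q * suc q)
    levels-bound-strict q 1≤q n<A = subst (λ N → (2 * q + 1) * N < Ψ + suc k * (q * suc q)) ∑levelSize≡n
      (level-bound-strict q k (levelSize G k vs) a s≤a a≤aₖ 1≤q (subst (_< A) (sym ∑levelSize≡n) n<A))

  edges≤t : suc k ≤ n → ∑[ i < suc k ] degAt G vs i ≤ k * n → edges G ≤ t (suc k) n
  edges≤t r≤n D≤kn with q , _ , identity ← turán-identity (s≤s z≤n) r≤n =
    halve-≤ vertex-bound identity (levels-bound q n≤A)
    where
    n≤A : n ≤ A
    n≤A = +-cancelʳ-≤ _ n A (≤-trans (+-monoʳ-≤ n D≤kn) (≤-reflexive (sym A+∑degAt)))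

  edges<t : suc k ≤ n → ∑[ i < suc k ] degAt G vs i < k * n → edges G < t (suc k) n
  edges<t r≤n D<kn with q , 1≤q , identity ← turán-identity (s≤s z≤n) r≤n =
    halve-< vertex-bound identity (levels-bound-strict q 1≤q n<A)
    where
    n<A : n < A
    n<A = +-cancelʳ-< _ n A (<-≤-trans (+-monoʳ-< n D<kn) (≤-reflexive (sym A+∑degAt)))

theorem1 : (r n : ℕ) → 2 ≤ r → r ≤ n → (G : Graph n) → t r n ≤ edges G →
    ((vs : List (Fin n)) → PSeq G vs → r ≤ length vs) ×
    ((vs : List (Fin n)) → PSeq G vs → (r ∸ 1) * n ≤ sum (map (deg G) (take r vs))) ×
    ((vs : List (Fin n)) → PSeq G vs → sum (map (deg G) (take r vs)) ≡ (r ∸ 1) * n → edges G ≡ t r n)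
theorem1 (suc k) n (s≤s 1≤k) r≤n G t≤m = length≥r , degree-sum≥ , equality⇒turán
  where
  ¬∑degAt<k*n : ∀ {vs} → PSeq G vs → ¬ ∑[ i < suc k ] degAt G vs i < k * n
  ¬∑degAt<k*n greedy D<kn = <⇒≱ (edges<t G k greedy r≤n D<kn) t≤m

  length≥r : (vs : List (Fin n)) → PSeq G vs → suc k ≤ length vs
  length≥r vs greedy = ≰⇒> λ len≤k →
    ¬∑degAt<k*n greedy (short⇒∑degAt<k*n G vs len≤k 1≤k (≤-trans (s≤s z≤n) r≤n))

  degree-sum≥ : (vs : List (Fin n)) → PSeq G vs → k * n ≤ sum (map (deg G) (take (suc k) vs))
  degree-sum≥ vs greedy rewrite sum-take≡∑degAt G (suc k) vs = ≮⇒≥ (¬∑degAt<k*n greedy)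

  equality⇒turán : (vs : List (Fin n)) → PSeq G vs →
                   sum (map (deg G) (take (suc k) vs)) ≡ k * n → edges G ≡ t (suc k) n
  equality⇒turán vs greedy D≡kn rewrite sum-take≡∑degAt G (suc k) vs =
    ≤-antisym (edges≤t G k greedy r≤n (≤-reflexive D≡kn)) t≤m
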